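{- For every graph $G$, $T_t(G) \leq \max\{\chi(G),\ T(G) + \lceil 2\chi(G)/3 \rceil\}$.
   Context: All graphs are finite and simple. A tessellation of a graph $G=(V,E)$ is a partition of $V$ into cliques (called tiles); an edge belongs to the tessellation if both its endpoints lie in the same tile. A $k$-tessellation cover of $G$ is a set of $k$ tessellations whose edges together cover $E$; $T(G)$ denotes the minimum $k$ for which $G$ has a $k$-tessellation cover. Equivalently, with $\Sigma=\{1,\dots,k\}$, a $k$-tessellation cover is a map $h$ assigning to each edge a nonempty subset of $\Sigma$ such that for each label $i$ the edges whose subset contains $i$ are exactly the edges of a tessellation. A $k$-total tessellation cover of $G$ is a pair $(f,h)$ where $f:V\to\Sigma$ is a proper vertex coloring and $h$ is a $k$-tessellation cover with labels in $\Sigma$, such that every edge $uv$ satisfies $f(u)\notin h(uv)$ and $f(v)\notin h(uv)$. The total tessellation cover number $T_t(G)$ is the minimum $k$ for which $G$ has a $k$-total tessellation cover. $\chi(G)$ is the chromatic number. -}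

module Defs where

open import Data.Nat using (ℕ; suc; _+_; _*_; _≤_; _⊔_)
open import Data.Nat.DivMod using (_/_)
open import Data.Fin using (Fin)
open import Data.Bool using (Bool; true; false)
open import Data.Product using (Σ; ∃; ∃-syntax; _×_; _,_)
open import Relation.Nullary using (¬_)
open import Relation.Binary.PropositionalEquality using (_≡_; _≢_)

record Graph : Set where
  field
    n      : ℕ
    adj    : Fin n → Fin n → Bool
    sym    : ∀ u v → adj u v ≡ adj v u
    irrefl : ∀ v → adj v v ≡ false

open Graph public

Edge : (G : Graph) → Fin (n G) → Fin (n G) → Set
Edge G u v = adj G u v ≡ true

-- A tessellation: a partition of V into cliques, given by assigning each vertex
-- a tile label (at most |V| tiles are ever needed, so labels in Fin n).
record Tessellation (G : Graph) : Set where
  field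
    tile   : Fin (n G) → Fin (n G)
    clique : ∀ u v → u ≢ v → tile u ≡ tile v → Edge G u v

open Tessellation public

InTess : {G : Graph} → Tessellation G → Fin (n G) → Fin (n G) → Set
InTess t u v = tile t u ≡ tile t v

-- A k-tessellation cover: k tessellations whose edges together cover E.
-- (h(uv) = { i | uv ∈ tess i } is then nonempty for every edge.)
record TessCover (G : Graph) (k : ℕ) : Set where
  field
    tess  : Fin k → Tessellation G
    cover : ∀ u v → Edge G u v → ∃[ i ] InTess (tess i) u v

ProperColoring : (G : Graph) (k : ℕ) → (Fin (n G) → Fin k) → Set
ProperColoring G k f = ∀ u v → Edge G u v → f u ≢ f v

Colorable : (G : Graph) → ℕ → Set
Colorable G k = Σ (Fin (n G) → Fin k) (ProperColoring G k)

-- A k-total tessellation cover (f , h): f proper colouring with colours in Σ = Fin k,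
-- h a k-tessellation cover with labels in Σ, and for every edge uv,
-- f(u) ∉ h(uv) and f(v) ∉ h(uv), i.e. uv is not an edge of tessellation f(u) nor f(v).
record TotalTessCover (G : Graph) (k : ℕ) : Set where
  field
    col    : Fin (n G) → Fin k
    proper : ProperColoring G k col
    tc     : TessCover G k
    totalˡ : ∀ u v → Edge G u v → ¬ InTess (TessCover.tess tc (col u)) u v
    totalʳ : ∀ u v → Edge G u v → ¬ InTess (TessCover.tess tc (col v)) u v

IsMin : (ℕ → Set) → ℕ → Set
IsMin P m = P m × (∀ k → P k → m ≤ k)

IsChromaticNumber : Graph → ℕ → Set
IsChromaticNumber G = IsMin (Colorable G)

IsTessCoverNumber : Graph → ℕ → Set
IsTessCoverNumber G = IsMin (TessCover G)

IsTotalTessCoverNumber : Graph → ℕ → Set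
IsTotalTessCoverNumber G = IsMin (TotalTessCover G)

⌈_/3⌉ : ℕ → ℕ
⌈ m /3⌉ = (m + 2) / 3

-- Fix a proper colouring with χ colours, a cover by tessellations t₀ … t_{T-1},
-- Q = ⌈2χ/3⌉ and k = max(χ, T + Q) labels. Label ℓ gets a tessellation with the
-- vertices of colour ℓ cut out as singleton tiles, so no edge at a vertex of colour ℓ
-- is covered by label ℓ and the cover is total by construction. Labels ℓ < Q carry
-- t_⌊ℓ/2⌋ and labels ℓ ≥ Q carry t_{ℓ-Q}. An edge of tᵢ has two endpoint colours; if
-- Q + i ≥ χ, label Q + i is no colour at all, and otherwise 2χ ≤ 3Q forces 2i + 1 < Q,
-- so the three labels Q + i, 2i, 2i + 1 carry tᵢ and one of them avoids both colours.
module Submission where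

open import Defs
open import Data.Nat as ℕ using (ℕ; suc; _+_; _*_; _∸_; _≤_; _<_; _<?_; _⊔_; ⌊_/2⌋)
open import Data.Nat.Properties
  using (m≤m+n; ≤⇒≯; >⇒≢; <⇒≢; n<1+n; <-≤-trans; <-trans; ≰⇒>; n≡⌊n+n/2⌋; n≡⌈n+n/2⌉;
         +-comm; *-comm; +-monoˡ-≤; +-monoʳ-<; ≤-pred; ≤-trans; ≤-reflexive; m≤m⊔n; m≤n⊔m;
         m+n∸m≡n; +-cancelʳ-≤; *-monoʳ-≤; module ≤-Reasoning)
open import Data.Nat.DivMod using (_%_; m≡m%n+[m/n]*n; m%n<n)
open import Data.Nat.Tactic.RingSolver using (solve-∀)
open import Data.Fin using (Fin; zero; suc; toℕ; fromℕ<; inject≤)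
open import Data.Fin.Properties
  using (toℕ-inject≤; toℕ-fromℕ<; toℕ<n; toℕ-injective) renaming (_≟_ to _≟ᶠ_)
open import Data.Product using (∃; ∃-syntax; _×_; _,_; proj₁; proj₂)
open import Data.Sum using (_⊎_; inj₁; inj₂)
open import Function using (_∘_)
open import Level using (Level)
open import Relation.Nullary using (¬_; yes; no; contradiction)
open import Relation.Nullary.Decidable using (¬?; _×-dec_; _⊎-dec_)
open import Relation.Unary as U using (Pred; _≐_)
open import Relation.Binary using (Rel; IsDecEquivalence)
open import Relation.Binary.PropositionalEquality
  using (_≡_; _≢_; refl; cong; subst; trans; module ≡-Reasoning)
  renaming (sym to ≡-sym)

private variable
  ℓ : Level
  m : ℕ

least : {P : Pred (Fin m) ℓ} → U.Decidable P → ∃ P → Fin m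
least {m = suc m} P? w with P? zero
... | yes _ = zero
least {m = suc m} P? (zero , p) | no ¬p = contradiction p ¬p
least {m = suc m} P? (suc x , p) | no _ = suc (least (P? ∘ suc) (x , p))

least-satisfies : {P : Pred (Fin m) ℓ} (P? : U.Decidable P) (w : ∃ P) → P (least P? w)
least-satisfies {m = suc m} P? w with P? zero
... | yes p = p
least-satisfies {m = suc m} P? (zero , p) | no ¬p = contradiction p ¬p
least-satisfies {m = suc m} P? (suc x , p) | no _ = least-satisfies (P? ∘ suc) (x , p)

least-cong : {P Q : Pred (Fin m) ℓ} (P? : U.Decidable P) (Q? : U.Decidable Q) →
  P ≐ Q → (v : ∃ P) (w : ∃ Q) → least P? v ≡ least Q? w
least-cong {m = suc m} P? Q? P≐Q v w with P? zero | Q? zero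
... | yes _ | yes _ = refl
... | yes p | no ¬q = contradiction (proj₁ P≐Q p) ¬q
... | no ¬p | yes q = contradiction (proj₂ P≐Q q) ¬p
least-cong {m = suc m} P? Q? P≐Q (zero , p) w | no ¬p | no _ = contradiction p ¬p
least-cong {m = suc m} P? Q? P≐Q (suc x , p) (zero , q) | no _ | no ¬q = contradiction q ¬q
least-cong {m = suc m} P? Q? P≐Q (suc x , p) (suc y , q) | no _ | no _ =
  cong suc (least-cong (P? ∘ suc) (Q? ∘ suc) (proj₁ P≐Q , proj₂ P≐Q) (x , p) (y , q))

module _ (G : Graph) where

  private
    V : Set
    V = Fin (n G)

  edge⇒≢ : ∀ {u v} → Edge G u v → u ≢ v
  edge⇒≢ {u} uv refl with trans (≡-sym uv) (irrefl G u)
  ... | ()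

  discrete : Tessellation G
  discrete = record { tile = λ u → u ; clique = λ u v u≢v u≡v → contradiction u≡v u≢v }

  module _ {_≈_ : Rel V ℓ} (≈-isDecEquivalence : IsDecEquivalence _≈_)
           (≈⇒edge : ∀ u v → u ≢ v → u ≈ v → Edge G u v) where

    open IsDecEquivalence ≈-isDecEquivalence
      renaming (refl to ≈-refl; sym to ≈-sym; trans to ≈-trans)

    representative : V → V
    representative w = least (λ x → x ≟ w) (w , ≈-refl)

    representative≈ : ∀ w → representative w ≈ w
    representative≈ w = least-satisfies (λ x → x ≟ w) (w , ≈-refl)

    ≈⇒same-representative : ∀ {u w} → u ≈ w → representative u ≡ representative w
    ≈⇒same-representative u≈w =
      least-cong (λ x → x ≟ _) (λ x → x ≟ _)
        ((λ x≈u → ≈-trans x≈u u≈w) , (λ x≈w → ≈-trans x≈w (≈-sym u≈w))) _ _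

    same-representative⇒≈ : ∀ {u v} → representative u ≡ representative v → u ≈ v
    same-representative⇒≈ {u} {v} same =
      ≈-trans (≈-sym (representative≈ u)) (subst (_≈ v) (≡-sym same) (representative≈ v))

    quotientTessellation : Tessellation G
    quotientTessellation = record
      { tile   = representative
      ; clique = λ u v u≢v same → ≈⇒edge u v u≢v (same-representative⇒≈ same) }

  module _ (t : Tessellation G) {X : Pred V ℓ} (X? : U.Decidable X) where

    Punctured : Rel V ℓ
    Punctured u w = u ≡ w ⊎ (¬ X u × ¬ X w × InTess t u w)

    punctured-isDecEquivalence : IsDecEquivalence Punctured
    punctured-isDecEquivalence = record
      { isEquivalence = record { refl = inj₁ refl ; sym = symmetric ; trans = transitive }
      ; _≟_ = λ u w → (u ≟ᶠ w) ⊎-dec (¬? (X? u) ×-dec ¬? (X? w) ×-dec (tile t u ≟ᶠ tile t w)) }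
      where
      symmetric : ∀ {u w} → Punctured u w → Punctured w u
      symmetric (inj₁ refl) = inj₁ refl
      symmetric (inj₂ (¬Xu , ¬Xw , same)) = inj₂ (¬Xw , ¬Xu , ≡-sym same)

      transitive : ∀ {u v w} → Punctured u v → Punctured v w → Punctured u w
      transitive (inj₁ refl) vw = vw
      transitive (inj₂ uv) (inj₁ refl) = inj₂ uv
      transitive (inj₂ (¬Xu , _ , uv)) (inj₂ (_ , ¬Xw , vw)) = inj₂ (¬Xu , ¬Xw , trans uv vw)

    punctured⇒edge : ∀ u v → u ≢ v → Punctured u v → Edge G u v
    punctured⇒edge u v u≢v (inj₁ u≡v) = contradiction u≡v u≢v
    punctured⇒edge u v u≢v (inj₂ (_ , _ , same)) = clique t u v u≢v same

    puncture : Tessellation G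
    puncture = quotientTessellation punctured-isDecEquivalence punctured⇒edge

    puncture-keeps : ∀ {u v} → ¬ X u → ¬ X v → InTess t u v → InTess puncture u v
    puncture-keeps ¬Xu ¬Xv same =
      ≈⇒same-representative punctured-isDecEquivalence punctured⇒edge (inj₂ (¬Xu , ¬Xv , same))

    puncture-avoids : ∀ {u v} → Edge G u v → InTess puncture u v → ¬ X u × ¬ X v
    puncture-avoids uv same
      with same-representative⇒≈ punctured-isDecEquivalence punctured⇒edge same
    ... | inj₁ u≡v = contradiction u≡v (edge⇒≢ uv)
    ... | inj₂ (¬Xu , ¬Xv , _) = ¬Xu , ¬Xv

slot : ℕ → ℕ → ℕ
slot Q ℓ with ℓ <? Q
... | yes _ = ⌊ ℓ /2⌋
... | no _ = ℓ ∸ Q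

slot-low : ∀ {Q ℓ} → ℓ < Q → slot Q ℓ ≡ ⌊ ℓ /2⌋
slot-low {Q} {ℓ} ℓ<Q with ℓ <? Q
... | yes _ = refl
... | no ℓ≮Q = contradiction ℓ<Q ℓ≮Q

slot-high : ∀ Q i → slot Q (Q + i) ≡ i
slot-high Q i with Q + i <? Q
... | yes Q+i<Q = contradiction Q+i<Q (≤⇒≯ (m≤m+n Q i))
... | no _ = m+n∸m≡n Q i

avoid-two : ∀ (a b x y z : ℕ) → x ≢ y → x ≢ z → y ≢ z →
  (a ≢ x × b ≢ x) ⊎ (a ≢ y × b ≢ y) ⊎ (a ≢ z × b ≢ z)
avoid-two a b x y z x≢y x≢z y≢z with a ℕ.≟ x | b ℕ.≟ x
... | no a≢x | no b≢x = inj₁ (a≢x , b≢x)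
... | yes refl | yes refl = inj₂ (inj₁ (x≢y , x≢y))
avoid-two a b x y z x≢y x≢z y≢z | yes refl | no _ with b ℕ.≟ y
... | yes refl = inj₂ (inj₂ (x≢z , y≢z))
... | no b≢y = inj₂ (inj₁ (x≢y , b≢y))
avoid-two a b x y z x≢y x≢z y≢z | no _ | yes refl with a ℕ.≟ y
... | yes refl = inj₂ (inj₂ (y≢z , x≢z))
... | no a≢y = inj₂ (inj₁ (a≢y , x≢y))

low-slots-fit : ∀ {χ Q i} → 2 * χ ≤ 3 * Q → Q + i < χ → suc (i + i) < Q
low-slots-fit {χ} {Q} {i} 2χ≤3Q Q+i<χ = +-cancelʳ-≤ (2 * Q) (suc (suc (i + i))) Q (begin
  suc (suc (i + i)) + 2 * Q ≡⟨ double-suc Q i ⟩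
  2 * suc (Q + i)           ≤⟨ *-monoʳ-≤ 2 Q+i<χ ⟩
  2 * χ                     ≤⟨ 2χ≤3Q ⟩
  Q + 2 * Q                 ∎)
  where
  open ≤-Reasoning
  double-suc : ∀ Q i → suc (suc (i + i)) + 2 * Q ≡ 2 * suc (Q + i)
  double-suc = solve-∀

free-label-low : ∀ {Q k i a b} → suc (i + i) < Q → Q + i < k →
  ∃[ ℓ ] ℓ < k × slot Q ℓ ≡ i × a ≢ ℓ × b ≢ ℓ
free-label-low {Q} {k} {i} {a} {b} 2i+1<Q Q+i<k =
  pick (avoid-two a b (Q + i) (i + i) (suc (i + i)) (>⇒≢ (<-≤-trans 2i<Q (m≤m+n Q i)))
                  (>⇒≢ (<-≤-trans 2i+1<Q (m≤m+n Q i))) (<⇒≢ (n<1+n (i + i))))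
  where
  2i<Q : i + i < Q
  2i<Q = <-trans (n<1+n (i + i)) 2i+1<Q

  below-Q : ∀ {ℓ} → ℓ < Q → ℓ < k
  below-Q ℓ<Q = <-trans (<-≤-trans ℓ<Q (m≤m+n Q i)) Q+i<k

  pick : (a ≢ Q + i × b ≢ Q + i) ⊎ (a ≢ i + i × b ≢ i + i) ⊎
         (a ≢ suc (i + i) × b ≢ suc (i + i)) →
    ∃[ ℓ ] ℓ < k × slot Q ℓ ≡ i × a ≢ ℓ × b ≢ ℓ
  pick (inj₁ (a≢ℓ , b≢ℓ)) = Q + i , Q+i<k , slot-high Q i , a≢ℓ , b≢ℓ
  pick (inj₂ (inj₁ (a≢ℓ , b≢ℓ))) =
    i + i , below-Q 2i<Q , trans (slot-low 2i<Q) (≡-sym (n≡⌊n+n/2⌋ i)) , a≢ℓ , b≢ℓ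
  pick (inj₂ (inj₂ (a≢ℓ , b≢ℓ))) =
    suc (i + i) , below-Q 2i+1<Q , trans (slot-low 2i+1<Q) (≡-sym (n≡⌈n+n/2⌉ i)) , a≢ℓ , b≢ℓ

free-label : ∀ {χ Q k i a b} → 2 * χ ≤ 3 * Q → Q + i < k → a < χ → b < χ →
  ∃[ ℓ ] ℓ < k × slot Q ℓ ≡ i × a ≢ ℓ × b ≢ ℓ
free-label {χ} {Q} {k} {i} 2χ≤3Q Q+i<k a<χ b<χ with χ ℕ.≤? Q + i
... | yes χ≤Q+i =
  Q + i , Q+i<k , slot-high Q i , <⇒≢ (<-≤-trans a<χ χ≤Q+i) , <⇒≢ (<-≤-trans b<χ χ≤Q+i)
... | no χ≰Q+i = free-label-low (low-slots-fit 2χ≤3Q (≰⇒> χ≰Q+i)) Q+i<k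

m≤3*⌈m/3⌉ : ∀ m → m ≤ 3 * ⌈ m /3⌉
m≤3*⌈m/3⌉ m = +-cancelʳ-≤ 2 m (3 * q) (begin
  m + 2               ≡⟨ m≡m%n+[m/n]*n (m + 2) 3 ⟩
  (m + 2) % 3 + q * 3 ≤⟨ +-monoˡ-≤ (q * 3) (≤-pred (m%n<n (m + 2) 3)) ⟩
  2 + q * 3           ≡⟨ +-comm 2 (q * 3) ⟩
  q * 3 + 2           ≡⟨ cong (_+ 2) (*-comm q 3) ⟩
  3 * q + 2           ∎)
  where
  open ≤-Reasoning
  q : ℕ
  q = ⌈ m /3⌉

lookupOr : ∀ {a} {A : Set a} {T} → (Fin T → A) → A → ℕ → A
lookupOr {T = T} f default j with j <? T
... | yes j<T = f (fromℕ< j<T)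
... | no _ = default

lookupOr-toℕ : ∀ {a} {A : Set a} {T} (f : Fin T → A) (default : A) (i : Fin T) →
  lookupOr f default (toℕ i) ≡ f i
lookupOr-toℕ {T = T} f default i with toℕ i <? T
... | yes i<T = cong f (toℕ-injective (toℕ-fromℕ< i<T))
... | no i≮T = contradiction (toℕ<n i) i≮T

totalTessCover : ∀ {G χ T k Q} → Colorable G χ → TessCover G T →
  χ ≤ k → T + Q ≤ k → 2 * χ ≤ 3 * Q → TotalTessCover G k
totalTessCover {G} {χ} {T} {k} {Q} (f , f-proper) cover χ≤k T+Q≤k 2χ≤3Q = record
  { col    = colour
  ; proper = colour-proper
  ; tc     = record { tess = layer ; cover = layer-cover }
  ; totalˡ = λ u v uv same → proj₁ (layer-avoids (colour u) uv same) refl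
  ; totalʳ = λ u v uv same → proj₂ (layer-avoids (colour v) uv same) refl
  }
  where
  open TessCover cover using (tess)

  colour : Fin (n G) → Fin k
  colour u = inject≤ (f u) χ≤k

  colour-proper : ProperColoring G k colour
  colour-proper u v uv same = f-proper u v uv (toℕ-injective (begin
    toℕ (f u)      ≡⟨ toℕ-inject≤ (f u) χ≤k ⟨
    toℕ (colour u) ≡⟨ cong toℕ same ⟩
    toℕ (colour v) ≡⟨ toℕ-inject≤ (f v) χ≤k ⟩
    toℕ (f v)      ∎))
    where open ≡-Reasoning

  tessAt : ℕ → Tessellation G
  tessAt = lookupOr tess (discrete G)

  base : Fin k → Tessellation G
  base ℓ = tessAt (slot Q (toℕ ℓ))

  hasColour? : ∀ ℓ → U.Decidable (λ w → colour w ≡ ℓ)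
  hasColour? ℓ w = colour w ≟ᶠ ℓ

  layer : Fin k → Tessellation G
  layer ℓ = puncture G (base ℓ) (hasColour? ℓ)

  layer-avoids : ∀ ℓ {u v} → Edge G u v → InTess (layer ℓ) u v → colour u ≢ ℓ × colour v ≢ ℓ
  layer-avoids ℓ = puncture-avoids G (base ℓ) (hasColour? ℓ)

  Q+i<k : ∀ (i : Fin T) → Q + toℕ i < k
  Q+i<k i = <-≤-trans (+-monoʳ-< Q (toℕ<n i)) (≤-trans (≤-reflexive (+-comm Q T)) T+Q≤k)

  layer-cover : ∀ u v → Edge G u v → ∃[ ℓ ] InTess (layer ℓ) u v
  layer-cover u v uv with TessCover.cover cover u v uv
  ... | i , same-i with free-label {i = toℕ i} 2χ≤3Q (Q+i<k i) (toℕ<n (f u)) (toℕ<n (f v))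
  ... | ℓ , ℓ<k , slot≡i , fu≢ℓ , fv≢ℓ =
    L , puncture-keeps G (base L) (hasColour? L) (avoids fu≢ℓ) (avoids fv≢ℓ)
          (subst (λ t → InTess t u v) (≡-sym slotted) same-i)
    where
    L : Fin k
    L = fromℕ< ℓ<k

    avoids : ∀ {w} → toℕ (f w) ≢ ℓ → colour w ≢ L
    avoids {w} fw≢ℓ same = fw≢ℓ (begin
      toℕ (f w)      ≡⟨ toℕ-inject≤ (f w) χ≤k ⟨
      toℕ (colour w) ≡⟨ cong toℕ same ⟩
      toℕ L          ≡⟨ toℕ-fromℕ< ℓ<k ⟩
      ℓ              ∎)
      where open ≡-Reasoning

    slotted : base L ≡ tess i
    slotted = begin
      tessAt (slot Q (toℕ L)) ≡⟨ cong (tessAt ∘ slot Q) (toℕ-fromℕ< ℓ<k) ⟩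
      tessAt (slot Q ℓ)       ≡⟨ cong tessAt slot≡i ⟩
      tessAt (toℕ i)          ≡⟨ lookupOr-toℕ tess (discrete G) i ⟩
      tess i                  ∎
      where open ≡-Reasoning

mainTheorem2 : (G : Graph) (χ T Tt : ℕ) →
    IsChromaticNumber G χ → IsTessCoverNumber G T → IsTotalTessCoverNumber G Tt →
    Tt ≤ χ ⊔ (T + ⌈ 2 * χ /3⌉)
mainTheorem2 G χ T Tt (colouring , _) (cover , _) (_ , least-total) =
  least-total (χ ⊔ (T + ⌈ 2 * χ /3⌉))
    (totalTessCover colouring cover (m≤m⊔n χ _) (m≤n⊔m χ _) (m≤3*⌈m/3⌉ (2 * χ)))
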